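{- Let $X = \langle x_1, \ldots, x_n \rangle$, $Y = \langle y_1, \ldots, y_m \rangle$ and $P = \langle p_1, \ldots, p_r \rangle$ be sequences over an alphabet $\Sigma$ with $n, m, r \ge 1$, and suppose $Z = \langle z_1, \ldots, z_\ell \rangle$ is a constrained longest common subsequence of $X$ and $Y$ with respect to $P$. Then: 1. If $x_n = y_m = p_r$, then $z_\ell = x_n = y_m = p_r$ and $Z_{\ell-1}$ is a constrained longest common subsequence of $X_{n-1}$ and $Y_{m-1}$ with respect to $P_{r-1}$. 2. If $x_n = y_m$ and $x_n \neq p_r$, then $z_\ell = x_n = y_m$ and $Z_{\ell-1}$ is a constrained longest common subsequence of $X_{n-1}$ and $Y_{m-1}$ with respect to $P$. 3. If $x_n \neq y_m$ and $z_\ell \neq x_n$, then $Z$ is a constrained longest common subsequence of $X_{n-1}$ and $Y$ with respect to $P$. 4. If $x_n \neq y_m$ and $z_\ell \neq y_m$, then $Z$ is a constrained longest common subsequence of $X$ and $Y_{m-1}$ with respect to $P$.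
   Context: A sequence is a finite string of characters over an alphabet $\Sigma$. A subsequence of a sequence $X$ is obtained by deleting some (not necessarily contiguous) characters of $X$. A common subsequence of $X$ and $Y$ is a subsequence of both. For a sequence $X = \langle x_1, \ldots, x_n\rangle$, $X_i = \langle x_1, \ldots, x_i\rangle$ denotes its $i$-th prefix ($X_0$ is the empty sequence); similarly for $Y_j$, $P_k$, $Z_i$. Given sequences $X, Y, P$, a constrained common subsequence of $X$ and $Y$ with respect to $P$ is a common subsequence $Z$ of $X$ and $Y$ such that $P$ is a subsequence of $Z$; a constrained longest common subsequence (CLCS) of $X$ and $Y$ with respect to $P$ is a longest such sequence. -}

module Defs where

open import Level using (Level)
open import Data.List using (List; length)
open import Data.List.Relation.Binary.Sublist.Propositional using (_⊆_)
open import Data.Nat using (_≤_)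
open import Data.Product using (_×_)

IsCCS : {a : Level} {Σ : Set a} → List Σ → List Σ → List Σ → List Σ → Set a
IsCCS X Y P Z = (Z ⊆ X) × (Z ⊆ Y) × (P ⊆ Z)

IsCLCS : {a : Level} {Σ : Set a} → List Σ → List Σ → List Σ → List Σ → Set a
IsCLCS X Y P Z = IsCCS X Y P Z × (∀ W → IsCCS X Y P W → length W ≤ length Z)

-- Appending a common letter x to a constrained common subsequence of X and Y yields one of
-- X ∷ʳ x and Y ∷ʳ x. Hence a CLCS of X ∷ʳ x and Y ∷ʳ x ends in x (otherwise it would lie in X
-- and Y and could be extended by x), and its prefix is maximal for X and Y. A CLCS whose last
-- letter differs from x already lies in X, and stays maximal there because shrinking the
-- sequences only removes competitors.
module Submission where

open import Defs
open import Level using (Level)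
open import Data.List using (List; _∷ʳ_)
open import Data.Product using (_×_; ∃₂)
open import Relation.Binary.PropositionalEquality using (_≡_; _≢_)

open import Data.List using ([]; _∷_; [_]; length; reverse; initLast; _∷ʳ′_)
open import Data.List.Properties using (length-++; reverse-++)
open import Data.List.Relation.Binary.Sublist.Propositional
  using (_⊆_; ⊆-refl; ⊆-trans; minimum)
import Data.List.Relation.Binary.Sublist.Propositional as Sublist
open import Data.List.Relation.Binary.Sublist.Propositional.Properties
  using (++⁺; ++⁺ʳ; reverse⁺; reverse⁻; length-mono-≤)
open import Data.Nat using (suc; _≤_; s≤s⁻¹)
open import Data.Nat.Properties using (+-comm; 1+n≰n; n≮0)
open import Data.Product using (_,_)
open import Data.Sum using (_⊎_; inj₁; inj₂)
open import Data.Empty using (⊥-elim)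
open import Relation.Nullary using (¬_)
open import Relation.Binary.PropositionalEquality using (refl; sym; trans; subst; subst₂; ≢-sym)

module _ {a : Level} {A : Set a} where

  private
    variable
      xs ys zs : List A
      x y : A

  length-∷ʳ : (xs : List A) (x : A) → length (xs ∷ʳ x) ≡ suc (length xs)
  length-∷ʳ xs x = trans (length-++ xs) (+-comm (length xs) 1)

  reverse-∷ʳ : (xs : List A) (x : A) → reverse (xs ∷ʳ x) ≡ x ∷ reverse xs
  reverse-∷ʳ xs x = reverse-++ xs [ x ]

  ⊆-∷ʳ : xs ⊆ xs ∷ʳ x
  ⊆-∷ʳ = ++⁺ʳ _ ⊆-refl

  ∷ʳ⁺ : xs ⊆ ys → xs ∷ʳ x ⊆ ys ∷ʳ x
  ∷ʳ⁺ xs⊆ys = ++⁺ xs⊆ys ⊆-refl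

  ∷-⊆-∷⁻ : x ∷ xs ⊆ y ∷ ys → (x ≡ y × xs ⊆ ys) ⊎ x ∷ xs ⊆ ys
  ∷-⊆-∷⁻ (x≡y Sublist.∷ xs⊆ys) = inj₁ (x≡y , xs⊆ys)
  ∷-⊆-∷⁻ (_ Sublist.∷ʳ s)     = inj₂ s

  ∷ʳ-⊆-∷ʳ⁻ : xs ∷ʳ x ⊆ ys ∷ʳ y → (x ≡ y × xs ⊆ ys) ⊎ xs ∷ʳ x ⊆ ys
  ∷ʳ-⊆-∷ʳ⁻ {xs} {x} {ys} {y} s
    with ∷-⊆-∷⁻ (subst₂ _⊆_ (reverse-∷ʳ xs x) (reverse-∷ʳ ys y) (reverse⁺ s))
  ... | inj₁ (x≡y , t) = inj₁ (x≡y , reverse⁻ t)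
  ... | inj₂ t         = inj₂ (reverse⁻ (subst (_⊆ reverse ys) (sym (reverse-∷ʳ xs x)) t))

  ∷ʳ-⊆-∷ʳ⇒⊆ : xs ∷ʳ x ⊆ ys ∷ʳ y → xs ⊆ ys
  ∷ʳ-⊆-∷ʳ⇒⊆ s with ∷ʳ-⊆-∷ʳ⁻ s
  ... | inj₁ (_ , t) = t
  ... | inj₂ t       = ⊆-trans ⊆-∷ʳ t

  ∷ʳ-⊆-∷ʳ⇒∷ʳ-⊆ : x ≢ y → xs ∷ʳ x ⊆ ys ∷ʳ y → xs ∷ʳ x ⊆ ys
  ∷ʳ-⊆-∷ʳ⇒∷ʳ-⊆ x≢y s with ∷ʳ-⊆-∷ʳ⁻ s
  ... | inj₁ (x≡y , _) = ⊥-elim (x≢y x≡y)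
  ... | inj₂ t         = t

  ⊆-∷ʳ⇒⊆ : (∀ zs′ z → zs ≡ zs′ ∷ʳ z → z ≢ y) → zs ⊆ ys ∷ʳ y → zs ⊆ ys
  ⊆-∷ʳ⇒⊆ {zs} {ys = ys} last≢y s with initLast zs
  ... | []        = minimum ys
  ... | zs′ ∷ʳ′ z = ∷ʳ-⊆-∷ʳ⇒∷ʳ-⊆ (last≢y zs′ z refl) s

module _ {a : Level} {A : Set a} where

  private
    variable
      X Y X′ Y′ P Q W Z : List A
      x x′ p : A

  IsCCS-∷ʳ : P ⊆ Q ∷ʳ x → IsCCS X Y Q W → IsCCS (X ∷ʳ x) (Y ∷ʳ x) P (W ∷ʳ x)
  IsCCS-∷ʳ P⊆Qx (W⊆X , W⊆Y , Q⊆W) = ∷ʳ⁺ W⊆X , ∷ʳ⁺ W⊆Y , ⊆-trans P⊆Qx (∷ʳ⁺ Q⊆W)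

  IsCLCS⇒¬IsCCS-∷ʳ : IsCLCS X Y P Z → ¬ IsCCS X Y P (Z ∷ʳ x)
  IsCLCS⇒¬IsCCS-∷ʳ {Z = Z} {x = x} (_ , maximal) ccs =
    1+n≰n (subst (_≤ length Z) (length-∷ʳ Z x) (maximal _ ccs))

  IsCLCS-mono : X′ ⊆ X → Y′ ⊆ Y → IsCLCS X Y P Z → IsCCS X′ Y′ P Z → IsCLCS X′ Y′ P Z
  IsCLCS-mono X′⊆X Y′⊆Y (_ , maximal) ccs =
    ccs , λ W (W⊆X′ , W⊆Y′ , P⊆W) → maximal W (⊆-trans W⊆X′ X′⊆X , ⊆-trans W⊆Y′ Y′⊆Y , P⊆W)

  IsCLCS-init : P ⊆ Q ∷ʳ x → IsCLCS (X ∷ʳ x) (Y ∷ʳ x) P (Z ∷ʳ x) → IsCCS X Y Q Z →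
                IsCLCS X Y Q Z
  IsCLCS-init {x = x} {Z = Z} P⊆Qx (_ , maximal) ccs = ccs , λ W ccsW →
    s≤s⁻¹ (subst₂ _≤_ (length-∷ʳ W x) (length-∷ʳ Z x) (maximal _ (IsCCS-∷ʳ P⊆Qx ccsW)))

  IsCLCS-last : IsCLCS (X ∷ʳ x) (Y ∷ʳ x) P (Z ∷ʳ x′) → x′ ≡ x
  IsCLCS-last clcs@((Zx′⊆Xx , Zx′⊆Yx , P⊆Zx′) , _) with ∷ʳ-⊆-∷ʳ⁻ Zx′⊆Xx | ∷ʳ-⊆-∷ʳ⁻ Zx′⊆Yx
  ... | inj₁ (x′≡x , _) | _               = x′≡x
  ... | inj₂ _          | inj₁ (x′≡x , _) = x′≡x
  ... | inj₂ Zx′⊆X      | inj₂ Zx′⊆Y      =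
    ⊥-elim (IsCLCS⇒¬IsCCS-∷ʳ clcs (∷ʳ⁺ Zx′⊆X , ∷ʳ⁺ Zx′⊆Y , ⊆-trans P⊆Zx′ ⊆-∷ʳ))

  IsCLCS-common-last : P ∷ʳ p ⊆ Q ∷ʳ x → (∀ {W} → P ∷ʳ p ⊆ W ∷ʳ x → Q ⊆ W) →
                       IsCLCS (X ∷ʳ x) (Y ∷ʳ x) (P ∷ʳ p) Z →
                       ∃₂ λ Z′ z → (Z ≡ Z′ ∷ʳ z) × (z ≡ x) × IsCLCS X Y Q Z′
  IsCLCS-common-last {P = P} {p = p} {Z = Z} _ _ ((_ , _ , Pp⊆Z) , _) with initLast Z
  ... | [] = ⊥-elim (n≮0 (subst (_≤ 0) (length-∷ʳ P p) (length-mono-≤ Pp⊆Z)))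
  IsCLCS-common-last Pp⊆Qx Q⊆prefix clcs@((Zz⊆Xx , Zz⊆Yx , Pp⊆Zz) , _) | Z′ ∷ʳ′ z
    with refl ← IsCLCS-last clcs =
    Z′ , z , refl , refl ,
    IsCLCS-init Pp⊆Qx clcs (∷ʳ-⊆-∷ʳ⇒⊆ Zz⊆Xx , ∷ʳ-⊆-∷ʳ⇒⊆ Zz⊆Yx , Q⊆prefix Pp⊆Zz)

theorem1 : {a : Level} {Σ : Set a} (Xs Ys Ps Z : List Σ) (x y p : Σ) →
    IsCLCS (Xs ∷ʳ x) (Ys ∷ʳ y) (Ps ∷ʳ p) Z →
    ((x ≡ y → y ≡ p → ∃₂ λ Z′ z → (Z ≡ Z′ ∷ʳ z) × (z ≡ x) × IsCLCS Xs Ys Ps Z′)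
    × (x ≡ y → x ≢ p → ∃₂ λ Z′ z → (Z ≡ Z′ ∷ʳ z) × (z ≡ x) × IsCLCS Xs Ys (Ps ∷ʳ p) Z′)
    × (x ≢ y → (∀ Z′ z → Z ≡ Z′ ∷ʳ z → z ≢ x) → IsCLCS Xs (Ys ∷ʳ y) (Ps ∷ʳ p) Z)
    × (x ≢ y → (∀ Z′ z → Z ≡ Z′ ∷ʳ z → z ≢ y) → IsCLCS (Xs ∷ʳ x) Ys (Ps ∷ʳ p) Z))
theorem1 Xs Ys Ps Z x y p clcs@((Z⊆Xx , Z⊆Yy , Pp⊆Z) , _) =
  (λ { refl refl → IsCLCS-common-last ⊆-refl ∷ʳ-⊆-∷ʳ⇒⊆ clcs })
  , (λ { refl x≢p → IsCLCS-common-last ⊆-∷ʳ (∷ʳ-⊆-∷ʳ⇒∷ʳ-⊆ (≢-sym x≢p)) clcs })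
  , (λ _ last≢x → IsCLCS-mono ⊆-∷ʳ ⊆-refl clcs (⊆-∷ʳ⇒⊆ last≢x Z⊆Xx , Z⊆Yy , Pp⊆Z))
  , (λ _ last≢y → IsCLCS-mono ⊆-refl ⊆-∷ʳ clcs (Z⊆Xx , ⊆-∷ʳ⇒⊆ last≢y Z⊆Yy , Pp⊆Z))
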